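{- Let $d\ge2$ and let $O_{d+1}$ be the Odd graph, with eigenvalues $\theta_i=(-1)^i(d+1-i)$, $0\le i\le d$. Then \[ \max_{1\le j\le d}\left\{\frac{1-w_d(\theta_j)}{1-w_1(\theta_j)}\right\}=\frac{1-w_d(\theta_2)}{1-w_1(\theta_2)}. \]
   Context: The Odd graph $O_{d+1}$ has as vertices the $d$-subsets of $\{1,\dots,2d+1\}$, two being adjacent iff they are disjoint; it is distance-regular of diameter $d$ with distinct adjacency eigenvalues $\theta_i=(-1)^i(d+1-i)$, $0\le i\le d$. For a distance-regular graph with valency $k$ and intersection numbers $b_i,c_i$, $a_i=k-b_i-c_i$, the cosine sequence of an eigenvalue $\theta$ is defined by $w_0(\theta)=1$, $w_1(\theta)=\theta/k$, $c_iw_{i-1}(\theta)+a_iw_i(\theta)+b_iw_{i+1}(\theta)=\theta w_i(\theta)$ ($1\le i\le d-1$). -}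

module Defs where

open import Data.Nat as ℕ using (ℕ; zero; suc; _∸_; _/_)
open import Data.Integer as ℤ using (ℤ; +_; -[1+_])
open import Data.Rational using (ℚ; 0ℚ; 1ℚ; _+_; _-_; _*_; _÷_; ≢-nonZero; _≟_)
import Data.Rational as Q
open import Relation.Nullary using (yes; no)

ℕ→ℚ : ℕ → ℚ
ℕ→ℚ n = (+ n) Q./ 1

ℤ→ℚ : ℤ → ℚ
ℤ→ℚ z = z Q./ 1

-- Division in ℚ, totalised by p / 0 = 0.  It is only ever applied to
-- nonzero divisors in the statement (b_i ≠ 0 for i < d, and
-- 1 - w₁(θ_j) ≠ 0 for j ≥ 1), so the convention is never used.
_÷₀_ : ℚ → ℚ → ℚ
p ÷₀ q with q ≟ 0ℚ
... | yes _  = 0ℚ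
... | no q≢0 = _÷_ p q {{≢-nonZero q≢0}}

-- Cosine sequence of θ for a distance-regular graph with valency k and
-- intersection numbers b_i, c_i (a_i = k - b_i - c_i):
--   w₀ = 1, w₁ = θ/k,
--   c_i w_{i-1} + a_i w_i + b_i w_{i+1} = θ w_i   (1 ≤ i ≤ d-1),
-- i.e. w_{i+1} = ((θ - a_i) w_i - c_i w_{i-1}) / b_i.
cosine : (k : ℕ) (b c : ℕ → ℕ) (θ : ℚ) → ℕ → ℚ
cosine k b c θ zero = 1ℚ
cosine k b c θ (suc zero) = θ ÷₀ ℕ→ℚ k
cosine k b c θ (suc (suc i)) =
  ((θ - a) * cosine k b c θ (suc i) - ℕ→ℚ (c (suc i)) * cosine k b c θ i)
    ÷₀ ℕ→ℚ (b (suc i))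
  where
  a : ℚ
  a = ℕ→ℚ k - ℕ→ℚ (b (suc i)) - ℕ→ℚ (c (suc i))

-- Intersection numbers of the Odd graph O_{d+1} (valency k = d+1,
-- diameter d):  c_i = ⌊(i+1)/2⌋,  b_i = (d+1) - ⌊(i+1)/2⌋  for 0 ≤ i ≤ d-1
-- (so b_{2j} = k-j, b_{2j+1} = k-j-1, c_{2j} = j, c_{2j+1} = j+1).
oddK : ℕ → ℕ
oddK d = suc d

oddC : ℕ → ℕ
oddC i = suc i / 2

oddB : ℕ → ℕ → ℕ
oddB d i = suc d ∸ (suc i / 2)

oddθ : ℕ → ℕ → ℚ
oddθ d i = ℤ→ℚ ((-[1+ 0 ]) ℤ.^ i ℤ.* (+ (suc d ∸ i)))

oddW : (d j i : ℕ) → ℚ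
oddW d j i = cosine (oddK d) (oddB d) oddC (oddθ d j) i

oddRatio : ℕ → ℕ → ℚ
oddRatio d j = (1ℚ - oddW d j d) ÷₀ (1ℚ - oddW d j 1)

{-# OPTIONS --safe #-}
-- Write d = j + p, so that θ_j = ±(p + 1), and let k = d + 1; then 1 - w_1(θ_j) = (k - θ_j)/k.
-- Since a_i = 0 for i < d, w_i(-θ) = (-1)^i w_i(θ), so only θ = p + 1 matters for |w_d(θ_j)|.
-- The sequence v_i = k_i w_i(θ) obeys c_{i+1} v_{i+1} + b_{i-1} v_{i-1} = θ v_i, and passing from
-- O_{d+1} to O_{d+2} the recurrence for the same θ is solved by v_i - v_{i-2}.  Starting from
-- v = k for the trivial eigenvalue of O_{p+1}, the sequence for θ_j in O_{j+p+1} is thus the j-fold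
-- second difference of the sphere sizes of O_{p+1}, and Pascal's rule gives |v_i| ≤ k_i, i.e.
-- |w_d(θ_j)| ≤ 1.  For j ≠ 2 also k - θ_j ≥ 4, so the ratio is at most 2k/(k - θ_j) ≤ k/2.
-- For θ_2 = d - 1 the cosines are an explicit quadratic in ⌊i/2⌋ or d - ⌊i/2⌋, which gives
-- w_d(θ_2) ≤ 0; with k - θ_2 = 2 the ratio at j = 2 is at least k/2.
module Submission where

open import Defs
import Algebra
open import Level using (0ℓ)
open import Data.Empty using (⊥-elim)
open import Data.Maybe.Base using (Maybe; just; nothing)
open import Data.Nat as ℕ using (ℕ; zero; suc; _∸_; z≤n; s≤s; ⌊_/2⌋; ⌈_/2⌉)
import Data.Nat.Properties as ℕ
import Data.Nat.DivMod as ℕ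
import Data.Nat.Coprimality as Coprime
open import Data.Nat.Combinatorics using (_C_; nC1≡n; nCk+nC[k+1]≡[n+1]C[k+1])
open import Data.Integer as ℤ using (ℤ; +_; -[1+_])
import Data.Integer.Properties as ℤ
import Data.Rational as ℚ
open import Data.Rational
  using (ℚ; mkℚ; 0ℚ; 1ℚ; ½; _+_; _-_; -_; _*_; 1/_; _≤_; _<_; ∣_∣; _≟_; ≢-nonZero; Positive; positive; nonNegative)
open import Data.Rational.Properties
open import Data.Product using (_×_; _,_)
open import Data.Sum using (_⊎_; inj₁; inj₂)
import Data.Sum
open import Relation.Nullary using (yes; no; contradiction)
open import Relation.Binary.PropositionalEquality
open import Tactic.RingSolver using (solve-∀)
import Data.Nat.Tactic.RingSolver as ℕ-Solver
open import Algebra.Properties.CommutativeSemigroup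
  (Algebra.CommutativeRing.*-commutativeSemigroup +-*-commutativeRing)
  using (xy∙z≈xz∙y; xy∙z≈x∙zy; x∙yz≈y∙xz)
import Tactic.RingSolver.Core.AlmostCommutativeRing as ACR

ℚ-ring : ACR.AlmostCommutativeRing 0ℓ 0ℓ
ℚ-ring = ACR.fromCommutativeRing +-*-commutativeRing 0≟
  where
  0≟ : ∀ p → Maybe (0ℚ ≡ p)
  0≟ p with 0ℚ ≟ p
  ... | yes 0≡p = just 0≡p
  ... | no _    = nothing

x≡x+y-y : ∀ x y → x ≡ x + y - y
x≡x+y-y = solve-∀ ℚ-ring

ℕ→ℚ≡mkℚ : ∀ n → ℕ→ℚ n ≡ mkℚ (+ n) 0 (Coprime.sym (Coprime.1-coprimeTo n))
ℕ→ℚ≡mkℚ n = normalize-coprime (Coprime.sym (Coprime.1-coprimeTo n))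

ℕ→ℚ-homo-+ : ∀ m n → ℕ→ℚ (m ℕ.+ n) ≡ ℕ→ℚ m + ℕ→ℚ n
ℕ→ℚ-homo-+ m n = begin
  ℕ→ℚ (m ℕ.+ n)                          ≡⟨ cong (ℚ._/ 1) +[m+n]≡+m*1++n*1 ⟩
  (+ m ℤ.* + 1 ℤ.+ + n ℤ.* + 1) ℚ./ 1   ≡⟨ cong₂ _+_ (ℕ→ℚ≡mkℚ m) (ℕ→ℚ≡mkℚ n) ⟨
  ℕ→ℚ m + ℕ→ℚ n                          ∎
  where
  open ≡-Reasoning
  +[m+n]≡+m*1++n*1 : + (m ℕ.+ n) ≡ + m ℤ.* + 1 ℤ.+ + n ℤ.* + 1
  +[m+n]≡+m*1++n*1 = trans (ℤ.pos-+ m n) (sym (cong₂ ℤ._+_ (ℤ.*-identityʳ (+ m)) (ℤ.*-identityʳ (+ n))))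

ℕ→ℚ-homo-* : ∀ m n → ℕ→ℚ (m ℕ.* n) ≡ ℕ→ℚ m * ℕ→ℚ n
ℕ→ℚ-homo-* m n = begin
  ℕ→ℚ (m ℕ.* n)        ≡⟨ cong (ℚ._/ 1) (ℤ.pos-* m n) ⟩
  (+ m ℤ.* + n) ℚ./ 1  ≡⟨ cong₂ _*_ (ℕ→ℚ≡mkℚ m) (ℕ→ℚ≡mkℚ n) ⟨
  ℕ→ℚ m * ℕ→ℚ n        ∎
  where open ≡-Reasoning

ℕ→ℚ-suc : ∀ n → ℕ→ℚ (suc n) ≡ 1ℚ + ℕ→ℚ n
ℕ→ℚ-suc = ℕ→ℚ-homo-+ 1

ℕ→ℚ-∸ : ∀ {m n} → n ℕ.≤ m → ℕ→ℚ (m ∸ n) ≡ ℕ→ℚ m - ℕ→ℚ n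
ℕ→ℚ-∸ {m} {n} n≤m = begin
  ℕ→ℚ (m ∸ n)                    ≡⟨ x≡x+y-y (ℕ→ℚ (m ∸ n)) (ℕ→ℚ n) ⟩
  ℕ→ℚ (m ∸ n) + ℕ→ℚ n - ℕ→ℚ n   ≡⟨ cong (_- ℕ→ℚ n) (ℕ→ℚ-homo-+ (m ∸ n) n) ⟨
  ℕ→ℚ (m ∸ n ℕ.+ n) - ℕ→ℚ n      ≡⟨ cong (λ k → ℕ→ℚ k - ℕ→ℚ n) (ℕ.m∸n+n≡m n≤m) ⟩
  ℕ→ℚ m - ℕ→ℚ n                  ∎
  where open ≡-Reasoning

ℕ→ℚ-nonNeg : ∀ n → 0ℚ ≤ ℕ→ℚ n
ℕ→ℚ-nonNeg n = subst (0ℚ ≤_) (sym (ℕ→ℚ≡mkℚ n)) (nonNegative⁻¹ _)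

ℕ→ℚ-pos : ∀ {n} → 0 ℕ.< n → 0ℚ < ℕ→ℚ n
ℕ→ℚ-pos {suc n} _ = subst (0ℚ <_) (sym (ℕ→ℚ≡mkℚ (suc n))) (positive⁻¹ _)

0<p⇒p≢0 : ∀ {p} → 0ℚ < p → p ≢ 0ℚ
0<p⇒p≢0 0<p = ≢-sym (<⇒≢ 0<p)

ℕ→ℚ-≢0 : ∀ {n} → n ≢ 0 → ℕ→ℚ n ≢ 0ℚ
ℕ→ℚ-≢0 n≢0 = 0<p⇒p≢0 (ℕ→ℚ-pos (ℕ.n≢0⇒n>0 n≢0))

ℕ→ℚ-mono-≤ : ∀ {m n} → m ℕ.≤ n → ℕ→ℚ m ≤ ℕ→ℚ n
ℕ→ℚ-mono-≤ {m} {n} m≤n = begin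
  ℕ→ℚ m                    ≡⟨ +-identityʳ (ℕ→ℚ m) ⟨
  ℕ→ℚ m + 0ℚ               ≤⟨ +-monoʳ-≤ (ℕ→ℚ m) (ℕ→ℚ-nonNeg (n ∸ m)) ⟩
  ℕ→ℚ m + ℕ→ℚ (n ∸ m)      ≡⟨ ℕ→ℚ-homo-+ m (n ∸ m) ⟨
  ℕ→ℚ (m ℕ.+ (n ∸ m))      ≡⟨ cong ℕ→ℚ (ℕ.m+[n∸m]≡n m≤n) ⟩
  ℕ→ℚ n                    ∎
  where open ≤-Reasoning

p÷₀q*q≡p : ∀ p {q} → q ≢ 0ℚ → p ÷₀ q * q ≡ p
p÷₀q*q≡p p {q} q≢0 with q ≟ 0ℚ
... | yes q≡0 = ⊥-elim (q≢0 q≡0)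
... | no q≢0′ = begin
  p * 1/ q * q    ≡⟨ *-assoc p (1/ q) q ⟩
  p * (1/ q * q)  ≡⟨ cong (p *_) (*-inverseˡ q) ⟩
  p * 1ℚ          ≡⟨ *-identityʳ p ⟩
  p               ∎
  where
  open ≡-Reasoning
  instance
    q≢0ᶦ : ℚ.NonZero q
    q≢0ᶦ = ≢-nonZero q≢0′

*-cancelʳ-≡ : ∀ {p q r} → r ≢ 0ℚ → p * r ≡ q * r → p ≡ q
*-cancelʳ-≡ {p} {q} {r} r≢0 pr≡qr = begin
  p              ≡⟨ pr/r≡p p ⟨
  p * r * 1/ r   ≡⟨ cong (_* 1/ r) pr≡qr ⟩
  q * r * 1/ r   ≡⟨ pr/r≡p q ⟩
  q              ∎
  where
  open ≡-Reasoning
  instance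
    r≢0ᶦ : ℚ.NonZero r
    r≢0ᶦ = ≢-nonZero r≢0
  pr/r≡p : ∀ p → p * r * 1/ r ≡ p
  pr/r≡p p = trans (*-assoc p r (1/ r)) (trans (cong (p *_) (*-inverseʳ r)) (*-identityʳ p))

induction₂ : {P : ℕ → Set} → P 0 → P 1 → (∀ i → P i → P (suc i) → P (suc (suc i))) → ∀ i → P i
induction₂ P₀ P₁ step zero          = P₀
induction₂ P₀ P₁ step (suc zero)    = P₁
induction₂ P₀ P₁ step (suc (suc i)) =
  step i (induction₂ P₀ P₁ step i) (induction₂ P₀ P₁ step (suc i))

[-1]^_ : ℕ → ℚ
[-1]^ zero  = 1ℚ
[-1]^ suc i = - ([-1]^ i)

[-1]^i≡±1 : ∀ i → [-1]^ i ≡ 1ℚ ⊎ [-1]^ i ≡ - 1ℚ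
[-1]^i≡±1 zero    = inj₁ refl
[-1]^i≡±1 (suc i) = Data.Sum.swap (Data.Sum.map (cong (-_)) (cong (-_)) ([-1]^i≡±1 i))

∣[-1]^i∣≡1 : ∀ i → ∣ [-1]^ i ∣ ≡ 1ℚ
∣[-1]^i∣≡1 zero    = refl
∣[-1]^i∣≡1 (suc i) = trans (∣-p∣≡∣p∣ ([-1]^ i)) (∣[-1]^i∣≡1 i)

module CosineSequence
  (k : ℕ) (b c : ℕ → ℕ) (n : ℕ) (k≢0 : k ≢ 0)
  (b+c≡k : ∀ {i} → i ℕ.< n → b i ℕ.+ c i ≡ k)
  (b≢0 : ∀ {i} → i ℕ.< n → b i ≢ 0)
  where

  K : ℚ
  K = ℕ→ℚ k

  B C : ℕ → ℚ
  B i = ℕ→ℚ (b i)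
  C i = ℕ→ℚ (c i)

  w : ℚ → ℕ → ℚ
  w = cosine k b c

  K≢0 : K ≢ 0ℚ
  K≢0 = ℕ→ℚ-≢0 k≢0

  B≢0 : ∀ {i} → i ℕ.< n → B i ≢ 0ℚ
  B≢0 i<n = ℕ→ℚ-≢0 (b≢0 i<n)

  K-B-C≡0 : ∀ {i} → i ℕ.< n → K - B i - C i ≡ 0ℚ
  K-B-C≡0 {i} i<n = begin
    K - B i - C i                          ≡⟨ cong (λ m → ℕ→ℚ m - B i - C i) (b+c≡k i<n) ⟨
    ℕ→ℚ (b i ℕ.+ c i) - B i - C i          ≡⟨ cong (λ x → x - B i - C i) (ℕ→ℚ-homo-+ (b i) (c i)) ⟩
    B i + C i - B i - C i                  ≡⟨ x+y-x-y≡0 (B i) (C i) ⟩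
    0ℚ                                     ∎
    where
    open ≡-Reasoning
    x+y-x-y≡0 : ∀ x y → x + y - x - y ≡ 0ℚ
    x+y-x-y≡0 = solve-∀ ℚ-ring

  cosine-rec : ∀ θ {i} → suc i ℕ.< n →
    w θ (suc (suc i)) * B (suc i) ≡ θ * w θ (suc i) - C (suc i) * w θ i
  cosine-rec θ {i} i+1<n = begin
    w θ (suc (suc i)) * B (suc i)
      ≡⟨ p÷₀q*q≡p _ (B≢0 i+1<n) ⟩
    (θ - (K - B (suc i) - C (suc i))) * w θ (suc i) - C (suc i) * w θ i
      ≡⟨ cong (λ a → (θ - a) * w θ (suc i) - C (suc i) * w θ i) (K-B-C≡0 i+1<n) ⟩
    (θ - 0ℚ) * w θ (suc i) - C (suc i) * w θ i
      ≡⟨ cong (λ x → x * w θ (suc i) - C (suc i) * w θ i) (+-identityʳ θ) ⟩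
    θ * w θ (suc i) - C (suc i) * w θ i                             ∎
    where open ≡-Reasoning

  cosine-unique : ∀ θ N (f : ℕ → ℚ) → f 0 ≡ N → K * f 1 ≡ θ * N →
    (∀ {i} → suc i ℕ.< n → B (suc i) * f (suc (suc i)) ≡ θ * f (suc i) - C (suc i) * f i) →
    ∀ {i} → i ℕ.≤ n → w θ i * N ≡ f i
  cosine-unique θ N f f₀ f₁ f-rec {i} = induction₂ P₀ P₁ P₂ i
    where
    open ≡-Reasoning
    P : ℕ → Set
    P i = i ℕ.≤ n → w θ i * N ≡ f i
    P₀ : P 0
    P₀ _ = trans (*-identityˡ N) (sym f₀)
    P₁ : P 1
    P₁ _ = *-cancelʳ-≡ K≢0 (begin
      w θ 1 * N * K   ≡⟨ xy∙z≈xz∙y (w θ 1) N K ⟩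
      w θ 1 * K * N   ≡⟨ cong (_* N) (p÷₀q*q≡p θ K≢0) ⟩
      θ * N           ≡⟨ f₁ ⟨
      K * f 1         ≡⟨ *-comm K (f 1) ⟩
      f 1 * K         ∎)
    P₂ : ∀ i → P i → P (suc i) → P (suc (suc i))
    P₂ i Pᵢ Pᵢ₊₁ i+2≤n = *-cancelʳ-≡ (B≢0 i+2≤n) (begin
      w θ (suc (suc i)) * N * B (suc i)
        ≡⟨ xy∙z≈xz∙y (w θ (suc (suc i))) N (B (suc i)) ⟩
      w θ (suc (suc i)) * B (suc i) * N
        ≡⟨ cong (_* N) (cosine-rec θ i+2≤n) ⟩
      (θ * w θ (suc i) - C (suc i) * w θ i) * N
        ≡⟨ [ax-cy]z≡a[xz]-c[yz] θ (w θ (suc i)) (C (suc i)) (w θ i) N ⟩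
      θ * (w θ (suc i) * N) - C (suc i) * (w θ i * N)
        ≡⟨ cong₂ (λ x y → θ * x - C (suc i) * y) (Pᵢ₊₁ i+1≤n) (Pᵢ i≤n) ⟩
      θ * f (suc i) - C (suc i) * f i
        ≡⟨ f-rec i+2≤n ⟨
      B (suc i) * f (suc (suc i))
        ≡⟨ *-comm (B (suc i)) (f (suc (suc i))) ⟩
      f (suc (suc i)) * B (suc i)                          ∎)
      where
      i+1≤n : suc i ℕ.≤ n
      i+1≤n = ℕ.<⇒≤ i+2≤n
      i≤n : i ℕ.≤ n
      i≤n = ℕ.<⇒≤ (ℕ.<⇒≤ i+2≤n)
      [ax-cy]z≡a[xz]-c[yz] : ∀ a x c y z → (a * x - c * y) * z ≡ a * (x * z) - c * (y * z)
      [ax-cy]z≡a[xz]-c[yz] = solve-∀ ℚ-ring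

  cosine-neg : ∀ θ {i} → i ℕ.≤ n → w (- θ) i ≡ [-1]^ i * w θ i
  cosine-neg θ i≤n =
    trans (sym (*-identityʳ _)) (cosine-unique (- θ) 1ℚ (λ i → [-1]^ i * w θ i) refl f₁ f-rec i≤n)
    where
    open ≡-Reasoning
    f₁ : K * (- 1ℚ * w θ 1) ≡ - θ * 1ℚ
    f₁ = begin
      K * (- 1ℚ * w θ 1)  ≡⟨ x[-1*y]≡-[yx]*1 K (w θ 1) ⟩
      - (w θ 1 * K) * 1ℚ  ≡⟨ cong (λ x → - x * 1ℚ) (p÷₀q*q≡p θ K≢0) ⟩
      - θ * 1ℚ            ∎
      where
      x[-1*y]≡-[yx]*1 : ∀ x y → x * (- 1ℚ * y) ≡ - (y * x) * 1ℚ
      x[-1*y]≡-[yx]*1 = solve-∀ ℚ-ring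
    f-rec : ∀ {i} → suc i ℕ.< n →
      B (suc i) * ([-1]^ suc (suc i) * w θ (suc (suc i))) ≡
        - θ * ([-1]^ suc i * w θ (suc i)) - C (suc i) * ([-1]^ i * w θ i)
    f-rec {i} i+1<n = begin
      B (suc i) * (- - ([-1]^ i) * w θ (suc (suc i)))
        ≡⟨ x[--s*y]≡s[yx] ([-1]^ i) (B (suc i)) (w θ (suc (suc i))) ⟩
      [-1]^ i * (w θ (suc (suc i)) * B (suc i))
        ≡⟨ cong ([-1]^ i *_) (cosine-rec θ i+1<n) ⟩
      [-1]^ i * (θ * w θ (suc i) - C (suc i) * w θ i)
        ≡⟨ s[tx-cy]≡-t[-sx]-c[sy] ([-1]^ i) θ (w θ (suc i)) (C (suc i)) (w θ i) ⟩
      - θ * (- ([-1]^ i) * w θ (suc i)) - C (suc i) * ([-1]^ i * w θ i) ∎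
      where
      x[--s*y]≡s[yx] : ∀ s x y → x * (- - s * y) ≡ s * (y * x)
      x[--s*y]≡s[yx] = solve-∀ ℚ-ring
      s[tx-cy]≡-t[-sx]-c[sy] : ∀ s t x c y → s * (t * x - c * y) ≡ - t * (- s * x) - c * (s * y)
      s[tx-cy]≡-t[-sx]-c[sy] = solve-∀ ℚ-ring

  cosine-dual : ∀ θ (κ v : ℕ → ℚ) → c 0 ≡ 0 → (∀ {i} → i ℕ.< n → c (suc i) ≢ 0) →
    κ 0 ≡ 1ℚ → (∀ {i} → i ℕ.< n → C (suc i) * κ (suc i) ≡ B i * κ i) →
    v 0 ≡ 1ℚ → C 1 * v 1 ≡ θ →
    (∀ {i} → suc i ℕ.< n → C (suc (suc i)) * v (suc (suc i)) ≡ θ * v (suc i) - B i * v i) →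
    ∀ {i} → i ℕ.≤ n → w θ i * κ i ≡ v i
  cosine-dual θ κ v c₀≡0 c≢0 κ₀ κ-rec v₀ v₁ v-rec {i} = induction₂ P₀ P₁ P₂ i
    where
    open ≡-Reasoning
    P : ℕ → Set
    P i = i ℕ.≤ n → w θ i * κ i ≡ v i
    P₀ : P 0
    P₀ _ = trans (*-identityˡ (κ 0)) (trans κ₀ (sym v₀))
    P₁ : P 1
    P₁ 0<n = *-cancelʳ-≡ (ℕ→ℚ-≢0 (c≢0 0<n)) (begin
      w θ 1 * κ 1 * C 1      ≡⟨ xy∙z≈x∙zy (w θ 1) (κ 1) (C 1) ⟩
      w θ 1 * (C 1 * κ 1)    ≡⟨ cong (w θ 1 *_) (κ-rec 0<n) ⟩
      w θ 1 * (B 0 * κ 0)    ≡⟨ cong (λ x → w θ 1 * (B 0 * x)) κ₀ ⟩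
      w θ 1 * (B 0 * 1ℚ)     ≡⟨ cong (w θ 1 *_) (trans (*-identityʳ (B 0)) B₀≡K) ⟩
      w θ 1 * K              ≡⟨ p÷₀q*q≡p θ K≢0 ⟩
      θ                      ≡⟨ v₁ ⟨
      C 1 * v 1              ≡⟨ *-comm (C 1) (v 1) ⟩
      v 1 * C 1              ∎)
      where
      B₀≡K : B 0 ≡ K
      B₀≡K = cong ℕ→ℚ (trans (sym (ℕ.+-identityʳ (b 0))) (trans (cong (b 0 ℕ.+_) (sym c₀≡0)) (b+c≡k 0<n)))
    P₂ : ∀ i → P i → P (suc i) → P (suc (suc i))
    P₂ i Pᵢ Pᵢ₊₁ i+2≤n = *-cancelʳ-≡ (ℕ→ℚ-≢0 (c≢0 i+2≤n)) (begin
      w₂ * κ (suc (suc i)) * C₂                  ≡⟨ xy∙z≈x∙zy w₂ (κ (suc (suc i))) C₂ ⟩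
      w₂ * (C₂ * κ (suc (suc i)))                ≡⟨ cong (w₂ *_) (κ-rec i+2≤n) ⟩
      w₂ * (B₁ * κ (suc i))                      ≡⟨ *-assoc w₂ B₁ (κ (suc i)) ⟨
      w₂ * B₁ * κ (suc i)                        ≡⟨ cong (_* κ (suc i)) (cosine-rec θ i+2≤n) ⟩
      (θ * w₁ - C₁ * w₀) * κ (suc i)             ≡⟨ [tx-cy]z≡t[xz]-y[cz] θ w₁ C₁ w₀ (κ (suc i)) ⟩
      θ * (w₁ * κ (suc i)) - w₀ * (C₁ * κ (suc i)) ≡⟨ cong (λ x → θ * (w₁ * κ (suc i)) - w₀ * x) (κ-rec i+1≤n) ⟩
      θ * (w₁ * κ (suc i)) - w₀ * (B i * κ i)    ≡⟨ tx-y[cz]≡tx-c[yz] θ (w₁ * κ (suc i)) w₀ (B i) (κ i) ⟩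
      θ * (w₁ * κ (suc i)) - B i * (w₀ * κ i)    ≡⟨ cong₂ (λ x y → θ * x - B i * y) (Pᵢ₊₁ i+1≤n) (Pᵢ i≤n) ⟩
      θ * v (suc i) - B i * v i                  ≡⟨ v-rec i+2≤n ⟨
      C₂ * v (suc (suc i))                       ≡⟨ *-comm C₂ (v (suc (suc i))) ⟩
      v (suc (suc i)) * C₂                       ∎)
      where
      w₀ w₁ w₂ B₁ C₁ C₂ : ℚ
      w₀ = w θ i
      w₁ = w θ (suc i)
      w₂ = w θ (suc (suc i))
      B₁ = B (suc i)
      C₁ = C (suc i)
      C₂ = C (suc (suc i))
      i+1≤n : suc i ℕ.≤ n
      i+1≤n = ℕ.<⇒≤ i+2≤n
      i≤n : i ℕ.≤ n
      i≤n = ℕ.<⇒≤ (ℕ.<⇒≤ i+2≤n)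
      [tx-cy]z≡t[xz]-y[cz] : ∀ t x c y z → (t * x - c * y) * z ≡ t * (x * z) - y * (c * z)
      [tx-cy]z≡t[xz]-y[cz] = solve-∀ ℚ-ring
      tx-y[cz]≡tx-c[yz] : ∀ t x y c z → t * x - y * (c * z) ≡ t * x - c * (y * z)
      tx-y[cz]≡tx-c[yz] = solve-∀ ℚ-ring

[1+k]*nC[1+k]+k*nCk≡n*nCk : ∀ n k → suc k ℕ.* (n C suc k) ℕ.+ k ℕ.* (n C k) ≡ n ℕ.* (n C k)
[1+k]*nC[1+k]+k*nCk≡n*nCk zero    zero    = refl
[1+k]*nC[1+k]+k*nCk≡n*nCk zero    (suc k) = cong₂ ℕ._+_ (ℕ.*-zeroʳ (suc (suc k))) (ℕ.*-zeroʳ (suc k))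
[1+k]*nC[1+k]+k*nCk≡n*nCk (suc n) zero    = begin
  1 ℕ.* (suc n C 1) ℕ.+ 0   ≡⟨ cong (λ m → 1 ℕ.* m ℕ.+ 0) (nC1≡n (suc n)) ⟩
  1 ℕ.* suc n ℕ.+ 0         ≡⟨ trans (ℕ.+-identityʳ _) (ℕ.*-identityˡ (suc n)) ⟩
  suc n                     ≡⟨ ℕ.*-identityʳ (suc n) ⟨
  suc n ℕ.* 1               ∎
  where open ≡-Reasoning
[1+k]*nC[1+k]+k*nCk≡n*nCk (suc n) (suc k) = begin
  suc (suc k) ℕ.* (suc n C suc (suc k)) ℕ.+ suc k ℕ.* (suc n C suc k)
    ≡⟨ cong₂ (λ x y → suc (suc k) ℕ.* x ℕ.+ suc k ℕ.* y)
             (nCk+nC[k+1]≡[n+1]C[k+1] n (suc k)) (nCk+nC[k+1]≡[n+1]C[k+1] n k) ⟨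
  suc (suc k) ℕ.* (b ℕ.+ c) ℕ.+ suc k ℕ.* (a ℕ.+ b)
    ≡⟨ regroup k a b c ⟩
  (suc (suc k) ℕ.* c ℕ.+ suc k ℕ.* b) ℕ.+ (suc k ℕ.* b ℕ.+ k ℕ.* a) ℕ.+ (a ℕ.+ b)
    ≡⟨ cong₂ (λ x y → x ℕ.+ y ℕ.+ (a ℕ.+ b))
             ([1+k]*nC[1+k]+k*nCk≡n*nCk n (suc k)) ([1+k]*nC[1+k]+k*nCk≡n*nCk n k) ⟩
  n ℕ.* b ℕ.+ n ℕ.* a ℕ.+ (a ℕ.+ b)
    ≡⟨ collect n a b ⟩
  suc n ℕ.* (a ℕ.+ b)
    ≡⟨ cong (suc n ℕ.*_) (nCk+nC[k+1]≡[n+1]C[k+1] n k) ⟩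
  suc n ℕ.* (suc n C suc k) ∎
  where
  open ≡-Reasoning
  a b c : ℕ
  a = n C k
  b = n C suc k
  c = n C suc (suc k)
  regroup : ∀ k a b c → suc (suc k) ℕ.* (b ℕ.+ c) ℕ.+ suc k ℕ.* (a ℕ.+ b) ≡
    (suc (suc k) ℕ.* c ℕ.+ suc k ℕ.* b) ℕ.+ (suc k ℕ.* b ℕ.+ k ℕ.* a) ℕ.+ (a ℕ.+ b)
  regroup = ℕ-Solver.solve-∀
  collect : ∀ n a b → n ℕ.* b ℕ.+ n ℕ.* a ℕ.+ (a ℕ.+ b) ≡ suc n ℕ.* (a ℕ.+ b)
  collect = ℕ-Solver.solve-∀

nCk-absorption : ∀ n k → (1ℚ + ℕ→ℚ k) * ℕ→ℚ (n C suc k) ≡ (ℕ→ℚ n - ℕ→ℚ k) * ℕ→ℚ (n C k)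
nCk-absorption n k = begin
  (1ℚ + K) * X₁                      ≡⟨ x≡x+y-y ((1ℚ + K) * X₁) (K * X₀) ⟩
  (1ℚ + K) * X₁ + K * X₀ - K * X₀    ≡⟨ cong (_- K * X₀) [1+k]X₁+kX₀≡nX₀ ⟩
  N * X₀ - K * X₀                    ≡⟨ nx-kx≡[n-k]x N K X₀ ⟩
  (N - K) * X₀                       ∎
  where
  open ≡-Reasoning
  K N X₀ X₁ : ℚ
  K = ℕ→ℚ k
  N = ℕ→ℚ n
  X₀ = ℕ→ℚ (n C k)
  X₁ = ℕ→ℚ (n C suc k)
  [1+k]X₁+kX₀≡nX₀ : (1ℚ + K) * X₁ + K * X₀ ≡ N * X₀
  [1+k]X₁+kX₀≡nX₀ = begin
    (1ℚ + K) * X₁ + K * X₀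
      ≡⟨ cong₂ _+_ (trans (ℕ→ℚ-homo-* (suc k) (n C suc k)) (cong (_* X₁) (ℕ→ℚ-suc k)))
                   (ℕ→ℚ-homo-* k (n C k)) ⟨
    ℕ→ℚ (suc k ℕ.* (n C suc k)) + ℕ→ℚ (k ℕ.* (n C k))
      ≡⟨ ℕ→ℚ-homo-+ (suc k ℕ.* (n C suc k)) (k ℕ.* (n C k)) ⟨
    ℕ→ℚ (suc k ℕ.* (n C suc k) ℕ.+ k ℕ.* (n C k))
      ≡⟨ cong ℕ→ℚ ([1+k]*nC[1+k]+k*nCk≡n*nCk n k) ⟩
    ℕ→ℚ (n ℕ.* (n C k))
      ≡⟨ ℕ→ℚ-homo-* n (n C k) ⟩
    N * X₀ ∎
  nx-kx≡[n-k]x : ∀ n k x → n * x - k * x ≡ (n - k) * x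
  nx-kx≡[n-k]x = solve-∀ ℚ-ring

nCk>0 : ∀ {n k} → k ℕ.≤ n → 0 ℕ.< n C k
nCk>0 {n}     {zero}  _         = s≤s z≤n
nCk>0 {suc n} {suc k} (s≤s k≤n) =
  ℕ.<-≤-trans (nCk>0 k≤n) (subst (n C k ℕ.≤_) (nCk+nC[k+1]≡[n+1]C[k+1] n k) (ℕ.m≤m+n _ _))

nCk≤[1+n]Ck : ∀ n k → n C k ℕ.≤ suc n C k
nCk≤[1+n]Ck n zero    = ℕ.≤-refl
nCk≤[1+n]Ck n (suc k) = subst (n C suc k ℕ.≤_) (nCk+nC[k+1]≡[n+1]C[k+1] n k) (ℕ.m≤n+m _ _)

n/2≡⌊n/2⌋ : ∀ n → n ℕ./ 2 ≡ ⌊ n /2⌋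
n/2≡⌊n/2⌋ zero          = refl
n/2≡⌊n/2⌋ (suc zero)    = refl
n/2≡⌊n/2⌋ (suc (suc n)) = trans (ℕ.m/n≡1+[m∸n]/n {suc (suc n)} {2} (s≤s (s≤s z≤n))) (cong suc (n/2≡⌊n/2⌋ n))

⌈n/2⌉≡⌊n/2⌋⊎⌈n/2⌉≡1+⌊n/2⌋ : ∀ n → ⌈ n /2⌉ ≡ ⌊ n /2⌋ ⊎ ⌈ n /2⌉ ≡ suc ⌊ n /2⌋
⌈n/2⌉≡⌊n/2⌋⊎⌈n/2⌉≡1+⌊n/2⌋ zero          = inj₁ refl
⌈n/2⌉≡⌊n/2⌋⊎⌈n/2⌉≡1+⌊n/2⌋ (suc zero)    = inj₂ refl
⌈n/2⌉≡⌊n/2⌋⊎⌈n/2⌉≡1+⌊n/2⌋ (suc (suc n)) =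
  Data.Sum.map (cong suc) (cong suc) (⌈n/2⌉≡⌊n/2⌋⊎⌈n/2⌉≡1+⌊n/2⌋ n)

oddC≡⌈i/2⌉ : ∀ i → oddC i ≡ ⌈ i /2⌉
oddC≡⌈i/2⌉ i = n/2≡⌊n/2⌋ (suc i)

-- The intersection numbers of O_{d+1} as rationals, with b_i not truncated at 0.
oddCℚ : ℕ → ℚ
oddCℚ i = ℕ→ℚ ⌈ i /2⌉

oddBℚ : ℕ → ℕ → ℚ
oddBℚ d i = ℕ→ℚ (suc d) - oddCℚ i

ℕ→ℚ-oddC : ∀ i → ℕ→ℚ (oddC i) ≡ oddCℚ i
ℕ→ℚ-oddC i = cong ℕ→ℚ (oddC≡⌈i/2⌉ i)

ℕ→ℚ-oddB : ∀ d {i} → ⌈ i /2⌉ ℕ.≤ suc d → ℕ→ℚ (oddB d i) ≡ oddBℚ d i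
ℕ→ℚ-oddB d {i} ⌈i/2⌉≤k = trans (cong (λ c → ℕ→ℚ (suc d ∸ c)) (oddC≡⌈i/2⌉ i)) (ℕ→ℚ-∸ ⌈i/2⌉≤k)

-- k_i, the number of vertices at distance i from a given vertex of O_{d+1}.
oddSphere : ℕ → ℕ → ℕ
oddSphere d i = (d C ⌊ i /2⌋) ℕ.* (suc d C ⌈ i /2⌉)

κ : ℕ → ℕ → ℚ
κ d i = ℕ→ℚ (oddSphere d i)

oddSphere>0 : ∀ {d i} → i ℕ.≤ d → 0 ℕ.< oddSphere d i
oddSphere>0 {d} {i} i≤d = ℕ.*-mono-≤ (nCk>0 ⌊i/2⌋≤d) (nCk>0 ⌈i/2⌉≤1+d)
  where
  ⌊i/2⌋≤d : ⌊ i /2⌋ ℕ.≤ d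
  ⌊i/2⌋≤d = ℕ.≤-trans (ℕ.⌊n/2⌋≤n i) i≤d
  ⌈i/2⌉≤1+d : ⌈ i /2⌉ ℕ.≤ suc d
  ⌈i/2⌉≤1+d = ℕ.m≤n⇒m≤1+n (ℕ.≤-trans (ℕ.⌈n/2⌉≤n i) i≤d)

oddSphere-mono : ∀ d i → oddSphere d i ℕ.≤ oddSphere (suc d) i
oddSphere-mono d i = ℕ.*-mono-≤ (nCk≤[1+n]Ck d ⌊ i /2⌋) (nCk≤[1+n]Ck (suc d) ⌈ i /2⌉)

oddSphere-pascal : ∀ d i → oddSphere d (suc (suc i)) ℕ.+ oddSphere d i ℕ.≤ oddSphere (suc d) (suc (suc i))
oddSphere-pascal d i = begin
  oddSphere d (suc (suc i)) ℕ.+ oddSphere d i  ≤⟨ by+ax≤[a+b][x+y] a b x y ⟩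
  (a ℕ.+ b) ℕ.* (x ℕ.+ y)
    ≡⟨ cong₂ ℕ._*_ (nCk+nC[k+1]≡[n+1]C[k+1] d ⌊ i /2⌋) (nCk+nC[k+1]≡[n+1]C[k+1] (suc d) ⌈ i /2⌉) ⟩
  oddSphere (suc d) (suc (suc i))              ∎
  where
  open ℕ.≤-Reasoning
  a b x y : ℕ
  a = d C ⌊ i /2⌋
  b = d C suc ⌊ i /2⌋
  x = suc d C ⌈ i /2⌉
  y = suc d C suc ⌈ i /2⌉
  by+ax≤[a+b][x+y] : ∀ a b x y → b ℕ.* y ℕ.+ a ℕ.* x ℕ.≤ (a ℕ.+ b) ℕ.* (x ℕ.+ y)
  by+ax≤[a+b][x+y] a b x y = subst (b ℕ.* y ℕ.+ a ℕ.* x ℕ.≤_) (expand a b x y) (ℕ.m≤m+n _ _)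
    where
    expand : ∀ a b x y → b ℕ.* y ℕ.+ a ℕ.* x ℕ.+ (a ℕ.* y ℕ.+ b ℕ.* x) ≡ (a ℕ.+ b) ℕ.* (x ℕ.+ y)
    expand = ℕ-Solver.solve-∀

oddSphere-rec : ∀ d i → oddCℚ (suc i) * κ d (suc i) ≡ oddBℚ d i * κ d i
oddSphere-rec d i = by-parity ⌊ i /2⌋ ⌈ i /2⌉ (⌈n/2⌉≡⌊n/2⌋⊎⌈n/2⌉≡1+⌊n/2⌋ i)
  where
  open ≡-Reasoning
  by-parity : ∀ f c → c ≡ f ⊎ c ≡ suc f →
    ℕ→ℚ (suc f) * ℕ→ℚ ((d C c) ℕ.* (suc d C suc f)) ≡
      (ℕ→ℚ (suc d) - ℕ→ℚ c) * ℕ→ℚ ((d C f) ℕ.* (suc d C c))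
  by-parity f .f (inj₁ refl) = begin
    ℕ→ℚ (suc f) * ℕ→ℚ (X ℕ.* Y₁)    ≡⟨ cong₂ _*_ (ℕ→ℚ-suc f) (ℕ→ℚ-homo-* X Y₁) ⟩
    (1ℚ + F) * (ℕ→ℚ X * ℕ→ℚ Y₁)     ≡⟨ x∙yz≈y∙xz (1ℚ + F) (ℕ→ℚ X) (ℕ→ℚ Y₁) ⟩
    ℕ→ℚ X * ((1ℚ + F) * ℕ→ℚ Y₁)     ≡⟨ cong (ℕ→ℚ X *_) (nCk-absorption (suc d) f) ⟩
    ℕ→ℚ X * ((K - F) * ℕ→ℚ Y₀)      ≡⟨ x∙yz≈y∙xz (ℕ→ℚ X) (K - F) (ℕ→ℚ Y₀) ⟩
    (K - F) * (ℕ→ℚ X * ℕ→ℚ Y₀)      ≡⟨ cong ((K - F) *_) (ℕ→ℚ-homo-* X Y₀) ⟨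
    (K - F) * ℕ→ℚ (X ℕ.* Y₀)        ∎
    where
    F K : ℚ
    F = ℕ→ℚ f
    K = ℕ→ℚ (suc d)
    X Y₀ Y₁ : ℕ
    X = d C f
    Y₀ = suc d C f
    Y₁ = suc d C suc f
  by-parity f .(suc f) (inj₂ refl) = begin
    ℕ→ℚ (suc f) * ℕ→ℚ (X₁ ℕ.* Y)       ≡⟨ cong₂ _*_ (ℕ→ℚ-suc f) (ℕ→ℚ-homo-* X₁ Y) ⟩
    (1ℚ + F) * (ℕ→ℚ X₁ * ℕ→ℚ Y)        ≡⟨ *-assoc (1ℚ + F) (ℕ→ℚ X₁) (ℕ→ℚ Y) ⟨
    (1ℚ + F) * ℕ→ℚ X₁ * ℕ→ℚ Y          ≡⟨ cong (_* ℕ→ℚ Y) (nCk-absorption d f) ⟩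
    (D - F) * ℕ→ℚ X₀ * ℕ→ℚ Y           ≡⟨ cong (λ x → x * ℕ→ℚ X₀ * ℕ→ℚ Y) D-F≡ ⟩
    (K - ℕ→ℚ (suc f)) * ℕ→ℚ X₀ * ℕ→ℚ Y ≡⟨ *-assoc (K - ℕ→ℚ (suc f)) (ℕ→ℚ X₀) (ℕ→ℚ Y) ⟩
    (K - ℕ→ℚ (suc f)) * (ℕ→ℚ X₀ * ℕ→ℚ Y) ≡⟨ cong ((K - ℕ→ℚ (suc f)) *_) (ℕ→ℚ-homo-* X₀ Y) ⟨
    (K - ℕ→ℚ (suc f)) * ℕ→ℚ (X₀ ℕ.* Y)   ∎
    where
    F D K : ℚ
    F = ℕ→ℚ f
    D = ℕ→ℚ d
    K = ℕ→ℚ (suc d)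
    X₀ X₁ Y : ℕ
    X₀ = d C f
    X₁ = d C suc f
    Y = suc d C suc f
    D-F≡ : D - F ≡ K - ℕ→ℚ (suc f)
    D-F≡ = begin
      D - F                    ≡⟨ x-y≡[1+x]-[1+y] D F ⟩
      (1ℚ + D) - (1ℚ + F)      ≡⟨ cong₂ _-_ (ℕ→ℚ-suc d) (ℕ→ℚ-suc f) ⟨
      K - ℕ→ℚ (suc f)          ∎
      where
      x-y≡[1+x]-[1+y] : ∀ x y → x - y ≡ (1ℚ + x) - (1ℚ + y)
      x-y≡[1+x]-[1+y] = solve-∀ ℚ-ring

-- The recurrence c_{i+1} v_{i+1} + b_{i-1} v_{i-1} = θ v_i of v_i = k_i w_i(θ) in O_{d+1}.
record IsOddDual (d : ℕ) (θ : ℚ) (v : ℕ → ℚ) : Set where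
  field
    initial : v 1 ≡ θ * v 0
    rec     : ∀ i → oddCℚ (suc (suc i)) * v (suc (suc i)) + oddBℚ d i * v i ≡ θ * v (suc i)

oddSphere-dual : ∀ d → IsOddDual d (ℕ→ℚ (suc d)) (κ d)
oddSphere-dual d = record { initial = initial ; rec = rec }
  where
  open ≡-Reasoning
  initial : κ d 1 ≡ ℕ→ℚ (suc d) * κ d 0
  initial = trans (cong ℕ→ℚ (trans (ℕ.*-identityˡ _) (nC1≡n (suc d)))) (sym (*-identityʳ _))
  rec : ∀ i → oddCℚ (suc (suc i)) * κ d (suc (suc i)) + oddBℚ d i * κ d i ≡ ℕ→ℚ (suc d) * κ d (suc i)
  rec i = begin
    oddCℚ (suc (suc i)) * κ d (suc (suc i)) + oddBℚ d i * κ d i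
      ≡⟨ cong₂ _+_ (oddSphere-rec d (suc i)) (sym (oddSphere-rec d i)) ⟩
    (ℕ→ℚ (suc d) - oddCℚ (suc i)) * κ d (suc i) + oddCℚ (suc i) * κ d (suc i)
      ≡⟨ [k-c]x+cx≡kx (ℕ→ℚ (suc d)) (oddCℚ (suc i)) (κ d (suc i)) ⟩
    ℕ→ℚ (suc d) * κ d (suc i) ∎
    where
    [k-c]x+cx≡kx : ∀ k c x → (k - c) * x + c * x ≡ k * x
    [k-c]x+cx≡kx = solve-∀ ℚ-ring

Δ₂ : (ℕ → ℚ) → ℕ → ℚ
Δ₂ v zero          = v 0
Δ₂ v (suc zero)    = v 1
Δ₂ v (suc (suc i)) = v (suc (suc i)) - v i

Δ₂-dual : ∀ {d θ v} → IsOddDual d θ v → IsOddDual (suc d) θ (Δ₂ v)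
Δ₂-dual {d} {θ} {v} dual = record { initial = initial ; rec = rec′ }
  where
  open IsOddDual dual
  open ≡-Reasoning
  K : ℚ
  K = ℕ→ℚ (suc d)
  θx-θy≡θ[x-y] : ∀ θ x y → θ * x - θ * y ≡ θ * (x - y)
  θx-θy≡θ[x-y] = solve-∀ ℚ-ring
  Δ₂-rec : ∀ {c₀ c₁ c₂ k k′ v₀ v₁ v₂ v₃ v₄} → c₁ ≡ 1ℚ + c₀ → c₂ ≡ 1ℚ + c₁ → k′ ≡ 1ℚ + k →
    c₁ * v₂ + (k - c₀) * v₀ ≡ θ * v₁ → c₂ * v₄ + (k - c₁) * v₂ ≡ θ * v₃ →
    c₂ * (v₄ - v₂) + (k′ - c₁) * (v₂ - v₀) ≡ θ * (v₃ - v₁)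
  Δ₂-rec {c₀} {_} {_} {k} {_} {v₀} {v₁} {v₂} {v₃} {v₄} refl refl refl rec₀ rec₂ = begin
    (1ℚ + (1ℚ + c₀)) * (v₄ - v₂) + ((1ℚ + k) - (1ℚ + c₀)) * (v₂ - v₀)
      ≡⟨ regroup c₀ k v₀ v₂ v₄ ⟩
    ((1ℚ + (1ℚ + c₀)) * v₄ + (k - (1ℚ + c₀)) * v₂) - ((1ℚ + c₀) * v₂ + (k - c₀) * v₀)
      ≡⟨ cong₂ _-_ rec₂ rec₀ ⟩
    θ * v₃ - θ * v₁
      ≡⟨ θx-θy≡θ[x-y] θ v₃ v₁ ⟩
    θ * (v₃ - v₁) ∎
    where
    regroup : ∀ c k v₀ v₂ v₄ → (1ℚ + (1ℚ + c)) * (v₄ - v₂) + ((1ℚ + k) - (1ℚ + c)) * (v₂ - v₀) ≡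
      ((1ℚ + (1ℚ + c)) * v₄ + (k - (1ℚ + c)) * v₂) - ((1ℚ + c) * v₂ + (k - c) * v₀)
    regroup = solve-∀ ℚ-ring
  rec′ : ∀ i → oddCℚ (suc (suc i)) * Δ₂ v (suc (suc i)) + oddBℚ (suc d) i * Δ₂ v i ≡ θ * Δ₂ v (suc i)
  rec′ zero = begin
    1ℚ * (v 2 - v 0) + (ℕ→ℚ (suc (suc d)) - 0ℚ) * v 0
      ≡⟨ cong (λ k → 1ℚ * (v 2 - v 0) + (k - 0ℚ) * v 0) (ℕ→ℚ-suc (suc d)) ⟩
    1ℚ * (v 2 - v 0) + ((1ℚ + K) - 0ℚ) * v 0
      ≡⟨ regroup K (v 0) (v 2) ⟩
    1ℚ * v 2 + (K - 0ℚ) * v 0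
      ≡⟨ rec 0 ⟩
    θ * v 1 ∎
    where
    regroup : ∀ k x₀ x₂ → 1ℚ * (x₂ - x₀) + ((1ℚ + k) - 0ℚ) * x₀ ≡ 1ℚ * x₂ + (k - 0ℚ) * x₀
    regroup = solve-∀ ℚ-ring
  rec′ (suc zero) = begin
    (1ℚ + 1ℚ) * (v 3 - v 1) + (ℕ→ℚ (suc (suc d)) - 1ℚ) * v 1
      ≡⟨ cong (λ k → (1ℚ + 1ℚ) * (v 3 - v 1) + (k - 1ℚ) * v 1) (ℕ→ℚ-suc (suc d)) ⟩
    (1ℚ + 1ℚ) * (v 3 - v 1) + ((1ℚ + K) - 1ℚ) * v 1
      ≡⟨ regroup K (v 1) (v 3) ⟩
    ((1ℚ + 1ℚ) * v 3 + (K - 1ℚ) * v 1) - v 1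
      ≡⟨ cong₂ _-_ (rec 1) initial ⟩
    θ * v 2 - θ * v 0
      ≡⟨ θx-θy≡θ[x-y] θ (v 2) (v 0) ⟩
    θ * (v 2 - v 0) ∎
    where
    regroup : ∀ k x₁ x₃ →
      (1ℚ + 1ℚ) * (x₃ - x₁) + ((1ℚ + k) - 1ℚ) * x₁ ≡ ((1ℚ + 1ℚ) * x₃ + (k - 1ℚ) * x₁) - x₁
    regroup = solve-∀ ℚ-ring
  rec′ (suc (suc i)) =
    Δ₂-rec {oddCℚ i} {oddCℚ (suc (suc i))} {oddCℚ (suc (suc (suc (suc i))))} {K}
         {v₀ = v i} {v (suc i)} {v (suc (suc i))} {v (suc (suc (suc i)))} {v (suc (suc (suc (suc i))))}
         (ℕ→ℚ-suc ⌈ i /2⌉) (ℕ→ℚ-suc (suc ⌈ i /2⌉)) (ℕ→ℚ-suc (suc d)) (rec i) (rec (suc (suc i)))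

-- The sequence k_i w_i(p + 1) of O_{j+p+1}: the j-fold Δ₂ of the sphere sizes of O_{p+1}.
oddV : ℕ → ℕ → ℕ → ℚ
oddV p zero    = κ p
oddV p (suc j) = Δ₂ (oddV p j)

oddV-dual : ∀ p j → IsOddDual (j ℕ.+ p) (ℕ→ℚ (suc p)) (oddV p j)
oddV-dual p zero    = oddSphere-dual p
oddV-dual p (suc j) = Δ₂-dual (oddV-dual p j)

oddV₀≡1 : ∀ p j → oddV p j 0 ≡ 1ℚ
oddV₀≡1 p zero    = refl
oddV₀≡1 p (suc j) = oddV₀≡1 p j

∣oddV∣≤κ : ∀ p j i → ∣ oddV p j i ∣ ≤ κ (j ℕ.+ p) i
∣oddV∣≤κ p zero i = ≤-reflexive (0≤p⇒∣p∣≡p (ℕ→ℚ-nonNeg (oddSphere p i)))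
∣oddV∣≤κ p (suc j) zero       = ≤-trans (∣oddV∣≤κ p j 0) (ℕ→ℚ-mono-≤ (oddSphere-mono (j ℕ.+ p) 0))
∣oddV∣≤κ p (suc j) (suc zero) = ≤-trans (∣oddV∣≤κ p j 1) (ℕ→ℚ-mono-≤ (oddSphere-mono (j ℕ.+ p) 1))
∣oddV∣≤κ p (suc j) (suc (suc i)) = begin
  ∣ oddV p j (suc (suc i)) - oddV p j i ∣        ≤⟨ ∣p-q∣≤∣p∣+∣q∣ (oddV p j (suc (suc i))) (oddV p j i) ⟩
  ∣ oddV p j (suc (suc i)) ∣ + ∣ oddV p j i ∣    ≤⟨ +-mono-≤ (∣oddV∣≤κ p j (suc (suc i))) (∣oddV∣≤κ p j i) ⟩
  κ d (suc (suc i)) + κ d i                       ≡⟨ ℕ→ℚ-homo-+ (oddSphere d (suc (suc i))) (oddSphere d i) ⟨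
  ℕ→ℚ (oddSphere d (suc (suc i)) ℕ.+ oddSphere d i) ≤⟨ ℕ→ℚ-mono-≤ (oddSphere-pascal d i) ⟩
  κ (suc d) (suc (suc i))                         ∎
  where
  open ≤-Reasoning
  d : ℕ
  d = j ℕ.+ p

oddCos : ℕ → ℚ → ℕ → ℚ
oddCos d = cosine (oddK d) (oddB d) oddC

oddC≤i+1 : ∀ i → oddC i ℕ.≤ suc i
oddC≤i+1 i = ℕ.m/n≤m (suc i) 2

oddB+oddC≡k : ∀ d {i} → i ℕ.< d → oddB d i ℕ.+ oddC i ≡ suc d
oddB+oddC≡k d {i} i<d = ℕ.m∸n+n≡m (ℕ.≤-trans (oddC≤i+1 i) (ℕ.m≤n⇒m≤1+n i<d))

oddB≢0 : ∀ d {i} → i ℕ.< d → oddB d i ≢ 0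
oddB≢0 d {i} i<d = ℕ.m<n⇒n≢0 (ℕ.m<n⇒0<n∸m (s≤s (ℕ.≤-trans (oddC≤i+1 i) i<d)))

module OddCosine (d : ℕ) = CosineSequence (suc d) (oddB d) oddC d (λ ()) (oddB+oddC≡k d) (oddB≢0 d)

IsOddDual⇒cosine : ∀ {d θ v} → IsOddDual d θ v → v 0 ≡ 1ℚ →
  ∀ {i} → i ℕ.≤ d → oddCos d θ i * κ d i ≡ v i
IsOddDual⇒cosine {d} {θ} {v} dual v₀≡1 =
  cosine-dual θ (κ d) v refl c≢0 refl κ-rec v₀≡1 v₁ v-rec
  where
  open OddCosine d
  open IsOddDual dual
  open ≡-Reasoning
  c≢0 : ∀ {i} → i ℕ.< d → oddC (suc i) ≢ 0
  c≢0 {i} _ = subst (_≢ 0) (sym (oddC≡⌈i/2⌉ (suc i))) λ ()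
  B≡oddBℚ : ∀ {i} → i ℕ.< d → B i ≡ oddBℚ d i
  B≡oddBℚ {i} i<d = ℕ→ℚ-oddB d (ℕ.≤-trans (ℕ.⌈n/2⌉≤n i) (ℕ.<⇒≤ (ℕ.m≤n⇒m≤1+n i<d)))
  κ-rec : ∀ {i} → i ℕ.< d → C (suc i) * κ d (suc i) ≡ B i * κ d i
  κ-rec {i} i<d = subst₂ (λ c b → c * κ d (suc i) ≡ b * κ d i)
    (sym (ℕ→ℚ-oddC (suc i))) (sym (B≡oddBℚ i<d)) (oddSphere-rec d i)
  v₁ : C 1 * v 1 ≡ θ
  v₁ = trans (*-identityˡ (v 1)) (trans initial (trans (cong (θ *_) v₀≡1) (*-identityʳ θ)))
  v-rec : ∀ {i} → suc i ℕ.< d → C (suc (suc i)) * v (suc (suc i)) ≡ θ * v (suc i) - B i * v i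
  v-rec {i} i+1<d = begin
    C (suc (suc i)) * v (suc (suc i))
      ≡⟨ cong (_* v (suc (suc i))) (ℕ→ℚ-oddC (suc (suc i))) ⟩
    oddCℚ (suc (suc i)) * v (suc (suc i))
      ≡⟨ x≡x+y-y _ (oddBℚ d i * v i) ⟩
    oddCℚ (suc (suc i)) * v (suc (suc i)) + oddBℚ d i * v i - oddBℚ d i * v i
      ≡⟨ cong₂ _-_ (rec i) (cong (_* v i) (sym (B≡oddBℚ (ℕ.<⇒≤ i+1<d)))) ⟩
    θ * v (suc i) - B i * v i ∎

∣oddCos∣≤1 : ∀ p j {i} → i ℕ.≤ j ℕ.+ p → ∣ oddCos (j ℕ.+ p) (ℕ→ℚ (suc p)) i ∣ ≤ 1ℚ
∣oddCos∣≤1 p j {i} i≤d = *-cancelʳ-≤-pos (κ d i) (begin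
  ∣ w ∣ * κ d i          ≡⟨ cong (∣ w ∣ *_) (0≤p⇒∣p∣≡p (ℕ→ℚ-nonNeg (oddSphere d i))) ⟨
  ∣ w ∣ * ∣ κ d i ∣      ≡⟨ ∣p*q∣≡∣p∣*∣q∣ w (κ d i) ⟨
  ∣ w * κ d i ∣          ≡⟨ cong ∣_∣ (IsOddDual⇒cosine (oddV-dual p j) (oddV₀≡1 p j) i≤d) ⟩
  ∣ oddV p j i ∣         ≤⟨ ∣oddV∣≤κ p j i ⟩
  κ d i                  ≡⟨ *-identityˡ (κ d i) ⟨
  1ℚ * κ d i             ∎)
  where
  open ≤-Reasoning
  d : ℕ
  d = j ℕ.+ p
  w : ℚ
  w = oddCos d (ℕ→ℚ (suc p)) i
  instance
    κ-pos : Positive (κ d i)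
    κ-pos = positive (ℕ→ℚ-pos (oddSphere>0 i≤d))

[-1]^j≡±1-ℤ : ∀ j → ((-[1+ 0 ]) ℤ.^ j ≡ + 1 × [-1]^ j ≡ 1ℚ) ⊎
                    ((-[1+ 0 ]) ℤ.^ j ≡ -[1+ 0 ] × [-1]^ j ≡ - 1ℚ)
[-1]^j≡±1-ℤ zero    = inj₁ (refl , refl)
[-1]^j≡±1-ℤ (suc j) = Data.Sum.swap (Data.Sum.map
  (λ (e , s) → cong (-[1+ 0 ] ℤ.*_) e , cong (-_) s)
  (λ (e , s) → cong (-[1+ 0 ] ℤ.*_) e , cong (-_) s) ([-1]^j≡±1-ℤ j))

ℤ→ℚ[[-1]^j*n]≡[-1]^j*n : ∀ j n → ℤ→ℚ ((-[1+ 0 ]) ℤ.^ j ℤ.* + n) ≡ [-1]^ j * ℕ→ℚ n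
ℤ→ℚ[[-1]^j*n]≡[-1]^j*n j n with [-1]^j≡±1-ℤ j
... | inj₁ (e , s) = begin
  ℤ→ℚ ((-[1+ 0 ]) ℤ.^ j ℤ.* + n)  ≡⟨ cong (λ z → ℤ→ℚ (z ℤ.* + n)) e ⟩
  ℤ→ℚ (+ 1 ℤ.* + n)               ≡⟨ cong ℤ→ℚ (ℤ.*-identityˡ (+ n)) ⟩
  ℕ→ℚ n                           ≡⟨ *-identityˡ (ℕ→ℚ n) ⟨
  1ℚ * ℕ→ℚ n                      ≡⟨ cong (_* ℕ→ℚ n) s ⟨
  [-1]^ j * ℕ→ℚ n                 ∎
  where open ≡-Reasoning
... | inj₂ (e , s) = begin
  ℤ→ℚ ((-[1+ 0 ]) ℤ.^ j ℤ.* + n)  ≡⟨ cong (λ z → ℤ→ℚ (z ℤ.* + n)) e ⟩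
  ℤ→ℚ (-[1+ 0 ] ℤ.* + n)          ≡⟨ cong ℤ→ℚ (ℤ.-1*i≡-i (+ n)) ⟩
  ℤ→ℚ (ℤ.- + n)                   ≡⟨ ℤ→ℚ-neg n ⟩
  - ℕ→ℚ n                         ≡⟨ cong (-_) (*-identityˡ (ℕ→ℚ n)) ⟨
  - (1ℚ * ℕ→ℚ n)                  ≡⟨ neg-distribˡ-* 1ℚ (ℕ→ℚ n) ⟩
  - 1ℚ * ℕ→ℚ n                    ≡⟨ cong (_* ℕ→ℚ n) s ⟨
  [-1]^ j * ℕ→ℚ n                 ∎
  where
  open ≡-Reasoning
  ℤ→ℚ-neg : ∀ n → ℤ→ℚ (ℤ.- + n) ≡ - ℕ→ℚ n
  ℤ→ℚ-neg zero    = refl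
  ℤ→ℚ-neg (suc n) = refl

oddθ≡[-1]^j*[p+1] : ∀ p j → oddθ (j ℕ.+ p) j ≡ [-1]^ j * ℕ→ℚ (suc p)
oddθ≡[-1]^j*[p+1] p j = begin
  ℤ→ℚ ((-[1+ 0 ]) ℤ.^ j ℤ.* + (suc (j ℕ.+ p) ∸ j))
    ≡⟨ cong (λ m → ℤ→ℚ ((-[1+ 0 ]) ℤ.^ j ℤ.* + m)) k∸j≡p+1 ⟩
  ℤ→ℚ ((-[1+ 0 ]) ℤ.^ j ℤ.* + suc p)
    ≡⟨ ℤ→ℚ[[-1]^j*n]≡[-1]^j*n j (suc p) ⟩
  [-1]^ j * ℕ→ℚ (suc p) ∎
  where
  open ≡-Reasoning
  k∸j≡p+1 : suc (j ℕ.+ p) ∸ j ≡ suc p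
  k∸j≡p+1 = trans (cong (_∸ j) (sym (ℕ.+-suc j p))) (ℕ.m+n∸m≡n j (suc p))

∣oddW∣≤1 : ∀ p j → ∣ oddW (j ℕ.+ p) j (j ℕ.+ p) ∣ ≤ 1ℚ
∣oddW∣≤1 p j = subst (_≤ 1ℚ) (sym ∣oddW∣≡∣w∣) (∣oddCos∣≤1 p j ℕ.≤-refl)
  where
  open ≡-Reasoning
  open OddCosine (j ℕ.+ p)
  d : ℕ
  d = j ℕ.+ p
  θ : ℚ
  θ = ℕ→ℚ (suc p)
  ∣oddW∣≡∣w∣ : ∣ oddW d j d ∣ ≡ ∣ oddCos d θ d ∣
  ∣oddW∣≡∣w∣ = trans (cong (λ θ′ → ∣ oddCos d θ′ d ∣) (oddθ≡[-1]^j*[p+1] p j)) (by-sign ([-1]^i≡±1 j))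
    where
    by-sign : ∀ {s} → s ≡ 1ℚ ⊎ s ≡ - 1ℚ → ∣ oddCos d (s * θ) d ∣ ≡ ∣ oddCos d θ d ∣
    by-sign (inj₁ refl) = cong (λ θ′ → ∣ oddCos d θ′ d ∣) (*-identityˡ θ)
    by-sign (inj₂ refl) = begin
      ∣ oddCos d (- 1ℚ * θ) d ∣       ≡⟨ cong (λ θ′ → ∣ oddCos d θ′ d ∣) -1*θ≡-θ ⟩
      ∣ oddCos d (- θ) d ∣            ≡⟨ cong ∣_∣ (cosine-neg θ ℕ.≤-refl) ⟩
      ∣ [-1]^ d * oddCos d θ d ∣      ≡⟨ ∣p*q∣≡∣p∣*∣q∣ ([-1]^ d) (oddCos d θ d) ⟩
      ∣ [-1]^ d ∣ * ∣ oddCos d θ d ∣  ≡⟨ cong (_* ∣ oddCos d θ d ∣) (∣[-1]^i∣≡1 d) ⟩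
      1ℚ * ∣ oddCos d θ d ∣           ≡⟨ *-identityˡ _ ⟩
      ∣ oddCos d θ d ∣                ∎
      where
      -1*θ≡-θ : - 1ℚ * θ ≡ - θ
      -1*θ≡-θ = trans (sym (neg-distribˡ-* 1ℚ θ)) (cong (-_) (*-identityˡ θ))

-- The cosines of θ₂ = D - 1 in O_{D+1}: N w_i(θ₂) = G D (τ D ⌊i/2⌋ ⌈i/2⌉),
-- where N = G D 0 = (D - 1) D (D + 1).
G : ℚ → ℚ → ℚ
G D T = (D - 1ℚ) * D * (1ℚ + D - ℕ→ℚ 4 * T) + ℕ→ℚ 2 * T * (T - 1ℚ) * (ℕ→ℚ 2 * D - 1ℚ)

-- ⌈ i /2⌉ - ⌊ i /2⌋ is the parity of i, so τ D m m = m and τ D m (1 + m) = D - m.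
τ : ℚ → ℚ → ℚ → ℚ
τ D F C = F + (C - F) * (D - (F + F))

-- The ring solver treats G and τ as atoms, so these identities are proved in unfolded form.
G-rec : ∀ D a → a * G D (a - 1ℚ) + ((1ℚ + D) - a) * G D a ≡ (D - 1ℚ) * G D ((1ℚ + D) - a)
G-rec = expanded
  where
  expanded : ∀ D a →
    a * ((D - 1ℚ) * D * (1ℚ + D - ℕ→ℚ 4 * (a - 1ℚ)) + ℕ→ℚ 2 * (a - 1ℚ) * ((a - 1ℚ) - 1ℚ) * (ℕ→ℚ 2 * D - 1ℚ))
      + ((1ℚ + D) - a) * ((D - 1ℚ) * D * (1ℚ + D - ℕ→ℚ 4 * a) + ℕ→ℚ 2 * a * (a - 1ℚ) * (ℕ→ℚ 2 * D - 1ℚ))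
    ≡ (D - 1ℚ) * ((D - 1ℚ) * D * (1ℚ + D - ℕ→ℚ 4 * ((1ℚ + D) - a))
                   + ℕ→ℚ 2 * ((1ℚ + D) - a) * (((1ℚ + D) - a) - 1ℚ) * (ℕ→ℚ 2 * D - 1ℚ))
  expanded = solve-∀ ℚ-ring

τ-even : ∀ D x → τ D x x ≡ x
τ-even = expanded
  where
  expanded : ∀ D x → x + (x - x) * (D - (x + x)) ≡ x
  expanded = solve-∀ ℚ-ring

τ-odd : ∀ D x → τ D x (1ℚ + x) ≡ (1ℚ + D) - (1ℚ + x)
τ-odd = expanded
  where
  expanded : ∀ D x → x + ((1ℚ + x) - x) * (D - (x + x)) ≡ (1ℚ + D) - (1ℚ + x)
  expanded = solve-∀ ℚ-ring

module SecondEigenvalue (p : ℕ) where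

  private
    d : ℕ
    d = suc (suc p)
    D : ℚ
    D = ℕ→ℚ d
    θ : ℚ
    θ = ℕ→ℚ (suc p)

  open OddCosine d

  t : ℕ → ℚ
  t i = τ D (ℕ→ℚ ⌊ i /2⌋) (ℕ→ℚ ⌈ i /2⌉)

  N : ℚ
  N = (D - 1ℚ) * D * (1ℚ + D)

  θ≡D-1 : θ ≡ D - 1ℚ
  θ≡D-1 = trans (x≡[1+x]-1 θ) (cong (_- 1ℚ) (sym (ℕ→ℚ-suc (suc p))))
    where
    x≡[1+x]-1 : ∀ x → x ≡ (1ℚ + x) - 1ℚ
    x≡[1+x]-1 = solve-∀ ℚ-ring

  G₀≡N : G D 0ℚ ≡ N
  G₀≡N = expanded D
    where
    expanded : ∀ D → (D - 1ℚ) * D * (1ℚ + D - ℕ→ℚ 4 * 0ℚ) + ℕ→ℚ 2 * 0ℚ * (0ℚ - 1ℚ) * (ℕ→ℚ 2 * D - 1ℚ) ≡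
                     (D - 1ℚ) * D * (1ℚ + D)
    expanded = solve-∀ ℚ-ring

  N>0 : 0ℚ < N
  N>0 = subst (0ℚ <_) (cong₂ (λ x y → x * D * y) θ≡D-1 (ℕ→ℚ-suc d))
    (positive⁻¹ (θ * D * ℕ→ℚ (suc d)) {{pos*pos⇒pos (θ * D) {{pos*pos⇒pos θ D}} (ℕ→ℚ (suc d))}})
    where
    instance
      θ>0 : Positive θ
      θ>0 = positive (ℕ→ℚ-pos {suc p} (s≤s z≤n))
      D>0 : Positive D
      D>0 = positive (ℕ→ℚ-pos {d} (s≤s z≤n))
      k>0 : Positive (ℕ→ℚ (suc d))
      k>0 = positive (ℕ→ℚ-pos {suc d} (s≤s z≤n))

  rec-by-parity : ∀ f c → c ≡ f ⊎ c ≡ 1ℚ + f →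
    ((1ℚ + D) - (1ℚ + f)) * G D (τ D (1ℚ + f) (1ℚ + c)) ≡
      (D - 1ℚ) * G D (τ D c (1ℚ + f)) - (1ℚ + f) * G D (τ D f c)
  rec-by-parity f .f (inj₁ refl) = begin
    b * G D (τ D (1ℚ + f) (1ℚ + f))                       ≡⟨ cong (λ x → b * G D x) (τ-even D (1ℚ + f)) ⟩
    b * G D (1ℚ + f)                                       ≡⟨ y≡x+y-x ((1ℚ + f) * G D ((1ℚ + f) - 1ℚ)) _ ⟩
    (1ℚ + f) * G D ((1ℚ + f) - 1ℚ) + b * G D (1ℚ + f) - (1ℚ + f) * G D ((1ℚ + f) - 1ℚ)
      ≡⟨ cong₂ _-_ (G-rec D (1ℚ + f)) (cong (λ x → (1ℚ + f) * G D x) ([1+x]-1≡x f)) ⟩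
    (D - 1ℚ) * G D b - (1ℚ + f) * G D f
      ≡⟨ cong₂ (λ x y → (D - 1ℚ) * G D x - (1ℚ + f) * G D y) (τ-odd D f) (τ-even D f) ⟨
    (D - 1ℚ) * G D (τ D f (1ℚ + f)) - (1ℚ + f) * G D (τ D f f) ∎
    where
    open ≡-Reasoning
    b : ℚ
    b = (1ℚ + D) - (1ℚ + f)
    y≡x+y-x : ∀ x y → y ≡ x + y - x
    y≡x+y-x = solve-∀ ℚ-ring
    [1+x]-1≡x : ∀ x → (1ℚ + x) - 1ℚ ≡ x
    [1+x]-1≡x = solve-∀ ℚ-ring
  rec-by-parity f .(1ℚ + f) (inj₂ refl) = begin
    a * G D (τ D (1ℚ + f) (1ℚ + (1ℚ + f)))                 ≡⟨ cong (λ x → a * G D x) (τ-odd D (1ℚ + f)) ⟩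
    a * G D ((1ℚ + D) - (1ℚ + (1ℚ + f)))                   ≡⟨ cong (λ x → a * G D x) (a-1≡ D f) ⟩
    a * G D (a - 1ℚ)                                       ≡⟨ x≡x+y-y (a * G D (a - 1ℚ)) _ ⟩
    a * G D (a - 1ℚ) + ((1ℚ + D) - a) * G D a - ((1ℚ + D) - a) * G D a
      ≡⟨ cong (_- ((1ℚ + D) - a) * G D a) (G-rec D a) ⟩
    (D - 1ℚ) * G D ((1ℚ + D) - a) - ((1ℚ + D) - a) * G D a
      ≡⟨ cong (λ x → (D - 1ℚ) * G D x - x * G D a) (k-a≡1+f D f) ⟩
    (D - 1ℚ) * G D (1ℚ + f) - (1ℚ + f) * G D a
      ≡⟨ cong₂ (λ x y → (D - 1ℚ) * G D x - (1ℚ + f) * G D y) (τ-even D (1ℚ + f)) (τ-odd D f) ⟨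
    (D - 1ℚ) * G D (τ D (1ℚ + f) (1ℚ + f)) - (1ℚ + f) * G D (τ D f (1ℚ + f)) ∎
    where
    open ≡-Reasoning
    a : ℚ
    a = (1ℚ + D) - (1ℚ + f)
    a-1≡ : ∀ D f → (1ℚ + D) - (1ℚ + (1ℚ + f)) ≡ ((1ℚ + D) - (1ℚ + f)) - 1ℚ
    a-1≡ = solve-∀ ℚ-ring
    k-a≡1+f : ∀ D f → (1ℚ + D) - ((1ℚ + D) - (1ℚ + f)) ≡ 1ℚ + f
    k-a≡1+f = solve-∀ ℚ-ring

  ⌈/2⌉≡⌊/2⌋⊎⌈/2⌉≡1+⌊/2⌋ : ∀ i → ℕ→ℚ ⌈ i /2⌉ ≡ ℕ→ℚ ⌊ i /2⌋ ⊎ ℕ→ℚ ⌈ i /2⌉ ≡ 1ℚ + ℕ→ℚ ⌊ i /2⌋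
  ⌈/2⌉≡⌊/2⌋⊎⌈/2⌉≡1+⌊/2⌋ i = Data.Sum.map (cong ℕ→ℚ) (λ e → trans (cong ℕ→ℚ e) (ℕ→ℚ-suc ⌊ i /2⌋))
    (⌈n/2⌉≡⌊n/2⌋⊎⌈n/2⌉≡1+⌊n/2⌋ i)

  cosine-θ₂ : ∀ {i} → i ℕ.≤ d → oddCos d θ i * N ≡ G D (t i)
  cosine-θ₂ = cosine-unique θ N (λ i → G D (t i)) f₀ f₁ f-rec
    where
    open ≡-Reasoning
    f₀ : G D (t 0) ≡ N
    f₀ = trans (cong (G D) (τ-even D 0ℚ)) G₀≡N
    f₁ : ℕ→ℚ (suc d) * G D (t 1) ≡ θ * N
    f₁ = begin
      ℕ→ℚ (suc d) * G D (τ D 0ℚ 1ℚ)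
        ≡⟨ cong₂ (λ k x → k * G D x) (ℕ→ℚ-suc d) (τ-odd D 0ℚ) ⟩
      (1ℚ + D) * G D ((1ℚ + D) - 1ℚ)
        ≡⟨ x≡x+[y-y]*z _ (1ℚ + D) (G D (1ℚ + D)) ⟩
      (1ℚ + D) * G D ((1ℚ + D) - 1ℚ) + ((1ℚ + D) - (1ℚ + D)) * G D (1ℚ + D)
        ≡⟨ G-rec D (1ℚ + D) ⟩
      (D - 1ℚ) * G D ((1ℚ + D) - (1ℚ + D))
        ≡⟨ cong (λ x → (D - 1ℚ) * G D x) (+-inverseʳ (1ℚ + D)) ⟩
      (D - 1ℚ) * G D 0ℚ
        ≡⟨ cong₂ _*_ (sym θ≡D-1) G₀≡N ⟩
      θ * N ∎
      where
      x≡x+[y-y]*z : ∀ x y z → x ≡ x + (y - y) * z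
      x≡x+[y-y]*z = solve-∀ ℚ-ring
    f-rec : ∀ {i} → suc i ℕ.< d →
      B (suc i) * G D (t (suc (suc i))) ≡ θ * G D (t (suc i)) - C (suc i) * G D (t i)
    f-rec {i} i+1<d = begin
      B (suc i) * G D (t (suc (suc i)))
        ≡⟨ cong₂ (λ x y → x * G D y) B≡ (cong₂ (τ D) (ℕ→ℚ-suc ⌊ i /2⌋) (ℕ→ℚ-suc ⌈ i /2⌉)) ⟩
      ((1ℚ + D) - (1ℚ + f)) * G D (τ D (1ℚ + f) (1ℚ + c))
        ≡⟨ rec-by-parity f c (⌈/2⌉≡⌊/2⌋⊎⌈/2⌉≡1+⌊/2⌋ i) ⟩
      (D - 1ℚ) * G D (τ D c (1ℚ + f)) - (1ℚ + f) * G D (τ D f c)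
        ≡⟨ cong₂ (λ x y → x * G D y - (1ℚ + f) * G D (τ D f c)) θ≡D-1 (cong (τ D c) (ℕ→ℚ-suc ⌊ i /2⌋)) ⟨
      θ * G D (t (suc i)) - (1ℚ + f) * G D (t i)
        ≡⟨ cong (λ x → θ * G D (t (suc i)) - x * G D (t i)) C≡ ⟨
      θ * G D (t (suc i)) - C (suc i) * G D (t i) ∎
      where
      f c : ℚ
      f = ℕ→ℚ ⌊ i /2⌋
      c = ℕ→ℚ ⌈ i /2⌉
      B≡ : B (suc i) ≡ (1ℚ + D) - (1ℚ + f)
      B≡ = trans (ℕ→ℚ-oddB d (ℕ.≤-trans (ℕ.⌈n/2⌉≤n (suc i)) (ℕ.m≤n⇒m≤1+n (ℕ.<⇒≤ i+1<d))))
                 (cong₂ _-_ (ℕ→ℚ-suc d) (ℕ→ℚ-suc ⌊ i /2⌋))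
      C≡ : C (suc i) ≡ 1ℚ + f
      C≡ = trans (ℕ→ℚ-oddC (suc i)) (ℕ→ℚ-suc ⌊ i /2⌋)

  G[t[d]]≤0 : G D (t d) ≤ 0ℚ
  G[t[d]]≤0 = subst (_≤ 0ℚ) (sym (cong (λ D → G D (τ D f c)) D≡f+c))
    (value-by-parity f c (ℕ→ℚ-nonNeg ⌊ d /2⌋) (⌈/2⌉≡⌊/2⌋⊎⌈/2⌉≡1+⌊/2⌋ d))
    where
    f c : ℚ
    f = ℕ→ℚ ⌊ d /2⌋
    c = ℕ→ℚ ⌈ d /2⌉
    D≡f+c : D ≡ f + c
    D≡f+c = trans (cong ℕ→ℚ (sym (ℕ.⌊n/2⌋+⌈n/2⌉≡n d))) (ℕ→ℚ-homo-+ ⌊ d /2⌋ ⌈ d /2⌉)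
    -[xy]≤0 : ∀ {x y} → 0ℚ ≤ x → 0ℚ ≤ y → - (x * y) ≤ 0ℚ
    -[xy]≤0 {x} {y} 0≤x 0≤y = neg-antimono-≤ (nonNegative⁻¹ (x * y)
      {{nonNeg*nonNeg⇒nonNeg x {{nonNegative 0≤x}} y {{nonNegative 0≤y}}}})
    value-by-parity : ∀ f c → 0ℚ ≤ f → c ≡ f ⊎ c ≡ 1ℚ + f → G (f + c) (τ (f + c) f c) ≤ 0ℚ
    value-by-parity f .f 0≤f (inj₁ refl) = begin
      G (f + f) (τ (f + f) f f)  ≡⟨ cong (G (f + f)) (τ-even (f + f) f) ⟩
      G (f + f) f                ≡⟨ expanded f ⟩
      - ((f + f) * f)            ≤⟨ -[xy]≤0 (+-mono-≤ 0≤f 0≤f) 0≤f ⟩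
      0ℚ                         ∎
      where
      open ≤-Reasoning
      expanded : ∀ f → (f + f - 1ℚ) * (f + f) * (1ℚ + (f + f) - ℕ→ℚ 4 * f)
                         + ℕ→ℚ 2 * f * (f - 1ℚ) * (ℕ→ℚ 2 * (f + f) - 1ℚ) ≡ - ((f + f) * f)
      expanded = solve-∀ ℚ-ring
    value-by-parity f .(1ℚ + f) 0≤f (inj₂ refl) = begin
      G D′ (τ D′ f (1ℚ + f))              ≡⟨ cong (G D′) (trans (τ-odd D′ f) ([1+x+[1+x]]-[1+x]≡1+x f)) ⟩
      G D′ (1ℚ + f)                       ≡⟨ expanded f ⟩
      - ((f + f) * (1ℚ + f))              ≤⟨ -[xy]≤0 (+-mono-≤ 0≤f 0≤f) (+-mono-≤ (<⇒≤ (positive⁻¹ 1ℚ)) 0≤f) ⟩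
      0ℚ                                  ∎
      where
      open ≤-Reasoning
      D′ : ℚ
      D′ = f + (1ℚ + f)
      [1+x+[1+x]]-[1+x]≡1+x : ∀ x → (1ℚ + (x + (1ℚ + x))) - (1ℚ + x) ≡ 1ℚ + x
      [1+x+[1+x]]-[1+x]≡1+x = solve-∀ ℚ-ring
      expanded : ∀ f → (f + (1ℚ + f) - 1ℚ) * (f + (1ℚ + f)) * (1ℚ + (f + (1ℚ + f)) - ℕ→ℚ 4 * (1ℚ + f))
                         + ℕ→ℚ 2 * (1ℚ + f) * ((1ℚ + f) - 1ℚ) * (ℕ→ℚ 2 * (f + (1ℚ + f)) - 1ℚ)
                       ≡ - ((f + f) * (1ℚ + f))
      expanded = solve-∀ ℚ-ring

  oddW₂≤0 : oddW d 2 d ≤ 0ℚ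
  oddW₂≤0 = *-cancelʳ-≤-pos N (begin
    oddW d 2 d * N       ≡⟨ cong (λ θ′ → oddCos d θ′ d * N) θ₂≡θ ⟩
    oddCos d θ d * N     ≡⟨ cosine-θ₂ ℕ.≤-refl ⟩
    G D (t d)            ≤⟨ G[t[d]]≤0 ⟩
    0ℚ                   ≡⟨ *-zeroˡ N ⟨
    0ℚ * N               ∎)
    where
    open ≤-Reasoning
    instance
      N>0ᶦ : Positive N
      N>0ᶦ = positive N>0
    θ₂≡θ : oddθ d 2 ≡ θ
    θ₂≡θ = trans (oddθ≡[-1]^j*[p+1] p 2) (*-identityˡ θ)

-p≤∣p∣ : ∀ p → - p ≤ ∣ p ∣
-p≤∣p∣ p with ∣p∣≡p∨∣p∣≡-p p
... | inj₁ ∣p∣≡p = ≤-trans (neg-antimono-≤ 0≤p) (subst (0ℚ ≤_) (sym ∣p∣≡p) 0≤p)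
  where
  0≤p : 0ℚ ≤ p
  0≤p = ∣p∣≡p⇒0≤p ∣p∣≡p
... | inj₂ ∣p∣≡-p = ≤-reflexive (sym ∣p∣≡-p)

k*[1-θ÷₀k]≡k-θ : ∀ {k} θ → k ≢ 0ℚ → k * (1ℚ - θ ÷₀ k) ≡ k - θ
k*[1-θ÷₀k]≡k-θ {k} θ k≢0 = begin
  k * (1ℚ - θ ÷₀ k)      ≡⟨ k[1-x]≡k-xk k (θ ÷₀ k) ⟩
  k - θ ÷₀ k * k         ≡⟨ cong (λ z → k - z) (p÷₀q*q≡p θ k≢0) ⟩
  k - θ                  ∎
  where
  open ≡-Reasoning
  k[1-x]≡k-xk : ∀ k x → k * (1ℚ - x) ≡ k - x * k
  k[1-x]≡k-xk = solve-∀ ℚ-ring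

0<1-θ÷₀k : ∀ {k θ} → 0ℚ < k → 0ℚ < k - θ → 0ℚ < 1ℚ - θ ÷₀ k
0<1-θ÷₀k {k} {θ} 0<k 0<k-θ = *-cancelˡ-<-nonNeg k {{nonNegative (<⇒≤ 0<k)}}
  (subst₂ _<_ (sym (*-zeroʳ k)) (sym (k*[1-θ÷₀k]≡k-θ θ (0<p⇒p≢0 0<k))) 0<k-θ)

ratio≤½k : ∀ {k θ x} → 0ℚ < k → ℕ→ℚ 4 ≤ k - θ → x ≤ ℕ→ℚ 2 → x ÷₀ (1ℚ - θ ÷₀ k) ≤ ½ * k
ratio≤½k {k} {θ} {x} 0<k 4≤k-θ x≤2 = *-cancelʳ-≤-pos y (begin
  x ÷₀ y * y          ≡⟨ p÷₀q*q≡p x (0<p⇒p≢0 0<y) ⟩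
  x                   ≤⟨ x≤2 ⟩
  ½ * ℕ→ℚ 4           ≤⟨ *-monoˡ-≤-nonNeg ½ 4≤k-θ ⟩
  ½ * (k - θ)         ≡⟨ cong (½ *_) (k*[1-θ÷₀k]≡k-θ θ (0<p⇒p≢0 0<k)) ⟨
  ½ * (k * y)         ≡⟨ *-assoc ½ k y ⟨
  ½ * k * y           ∎)
  where
  open ≤-Reasoning
  y : ℚ
  y = 1ℚ - θ ÷₀ k
  0<y : 0ℚ < y
  0<y = 0<1-θ÷₀k 0<k (<-≤-trans (positive⁻¹ (ℕ→ℚ 4)) 4≤k-θ)
  instance
    y>0 : Positive y
    y>0 = positive 0<y

½k≤ratio : ∀ {k θ x} → 0ℚ < k → k - θ ≡ ℕ→ℚ 2 → 1ℚ ≤ x → ½ * k ≤ x ÷₀ (1ℚ - θ ÷₀ k)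
½k≤ratio {k} {θ} {x} 0<k k-θ≡2 1≤x = *-cancelʳ-≤-pos y (begin
  ½ * k * y           ≡⟨ *-assoc ½ k y ⟩
  ½ * (k * y)         ≡⟨ cong (½ *_) (trans (k*[1-θ÷₀k]≡k-θ θ (0<p⇒p≢0 0<k)) k-θ≡2) ⟩
  ½ * ℕ→ℚ 2           ≤⟨ 1≤x ⟩
  x                   ≡⟨ p÷₀q*q≡p x (0<p⇒p≢0 0<y) ⟨
  x ÷₀ y * y          ∎)
  where
  open ≤-Reasoning
  y : ℚ
  y = 1ℚ - θ ÷₀ k
  0<y : 0ℚ < y
  0<y = 0<1-θ÷₀k 0<k (subst (0ℚ <_) (sym k-θ≡2) (positive⁻¹ (ℕ→ℚ 2)))
  instance
    y>0 : Positive y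
    y>0 = positive 0<y

4≤k-θⱼ : ∀ p j → 2 ℕ.≤ j ℕ.+ p → 1 ℕ.≤ j → j ≢ 2 → ℕ→ℚ 4 ≤ ℕ→ℚ (suc (j ℕ.+ p)) - oddθ (j ℕ.+ p) j
4≤k-θⱼ p j 2≤d 1≤j j≢2 =
  subst (λ θ → ℕ→ℚ 4 ≤ K - θ) (sym (oddθ≡[-1]^j*[p+1] p j)) (bound ([-1]^i≡±1 j))
  where
  open ≤-Reasoning
  K : ℚ
  K = ℕ→ℚ (suc (j ℕ.+ p))
  P : ℚ
  P = ℕ→ℚ (suc p)
  K≡j+P : K ≡ ℕ→ℚ j + P
  K≡j+P = trans (cong ℕ→ℚ (sym (ℕ.+-suc j p))) (ℕ→ℚ-homo-+ j (suc p))
  4≤j : ∀ {j} → 1 ℕ.≤ j → j ≢ 2 → [-1]^ j ≡ 1ℚ → 4 ℕ.≤ j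
  4≤j {suc zero}                _ _   s = contradiction s λ ()
  4≤j {suc (suc zero)}          _ j≢2 _ = contradiction refl j≢2
  4≤j {suc (suc (suc zero))}    _ _   s = contradiction s λ ()
  4≤j {suc (suc (suc (suc j)))} _ _   _ = s≤s (s≤s (s≤s (s≤s z≤n)))
  bound : [-1]^ j ≡ 1ℚ ⊎ [-1]^ j ≡ - 1ℚ → ℕ→ℚ 4 ≤ K - [-1]^ j * P
  bound (inj₁ s) = begin
    ℕ→ℚ 4                    ≤⟨ ℕ→ℚ-mono-≤ (4≤j 1≤j j≢2 s) ⟩
    ℕ→ℚ j                    ≡⟨ x≡[x+y]-1*y (ℕ→ℚ j) P ⟩
    ℕ→ℚ j + P - 1ℚ * P       ≡⟨ cong₂ (λ k s → k - s * P) K≡j+P s ⟨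
    K - [-1]^ j * P          ∎
    where
    x≡[x+y]-1*y : ∀ x y → x ≡ x + y - 1ℚ * y
    x≡[x+y]-1*y = solve-∀ ℚ-ring
  bound (inj₂ s) = begin
    ℕ→ℚ 4                    ≤⟨ ℕ→ℚ-mono-≤ (ℕ.+-mono-≤ (s≤s 2≤d) (s≤s z≤n)) ⟩
    ℕ→ℚ (suc (j ℕ.+ p) ℕ.+ suc p) ≡⟨ ℕ→ℚ-homo-+ (suc (j ℕ.+ p)) (suc p) ⟩
    K + P                    ≡⟨ x+y≡x-[-1]*y K P ⟩
    K - - 1ℚ * P             ≡⟨ cong (λ s → K - s * P) s ⟨
    K - [-1]^ j * P          ∎
    where
    x+y≡x-[-1]*y : ∀ x y → x + y ≡ x - - 1ℚ * y
    x+y≡x-[-1]*y = solve-∀ ℚ-ring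

k-θ₂≡2 : ∀ p → ℕ→ℚ (suc (2 ℕ.+ p)) - oddθ (2 ℕ.+ p) 2 ≡ ℕ→ℚ 2
k-θ₂≡2 p = begin
  ℕ→ℚ (suc (2 ℕ.+ p)) - oddθ (2 ℕ.+ p) 2   ≡⟨ cong₂ _-_ (ℕ→ℚ-homo-+ 2 (suc p)) (oddθ≡[-1]^j*[p+1] p 2) ⟩
  ℕ→ℚ 2 + P - 1ℚ * P                        ≡⟨ [x+y]-1*y≡x (ℕ→ℚ 2) P ⟩
  ℕ→ℚ 2                                     ∎
  where
  open ≡-Reasoning
  P : ℚ
  P = ℕ→ℚ (suc p)
  [x+y]-1*y≡x : ∀ x y → x + y - 1ℚ * y ≡ x
  [x+y]-1*y≡x = solve-∀ ℚ-ring

oddRatio≤½k : ∀ {d j} → 2 ℕ.≤ d → 1 ℕ.≤ j → j ℕ.≤ d → j ≢ 2 → oddRatio d j ≤ ½ * ℕ→ℚ (suc d)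
oddRatio≤½k {d} {j} 2≤d 1≤j j≤d j≢2 =
  subst (λ d → oddRatio d j ≤ ½ * ℕ→ℚ (suc d)) (ℕ.m+[n∸m]≡n j≤d)
  (ratio≤½k {ℕ→ℚ (suc (j ℕ.+ p))} {oddθ (j ℕ.+ p) j} (ℕ→ℚ-pos {suc (j ℕ.+ p)} (s≤s z≤n))
             (4≤k-θⱼ p j 2≤j+p 1≤j j≢2) (1-x≤2 (∣oddW∣≤1 p j)))
  where
  p : ℕ
  p = d ∸ j
  2≤j+p : 2 ℕ.≤ j ℕ.+ p
  2≤j+p = subst (2 ℕ.≤_) (sym (ℕ.m+[n∸m]≡n j≤d)) 2≤d
  1-x≤2 : ∀ {x} → ∣ x ∣ ≤ 1ℚ → 1ℚ - x ≤ ℕ→ℚ 2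
  1-x≤2 {x} ∣x∣≤1 = +-monoʳ-≤ 1ℚ (≤-trans (-p≤∣p∣ x) ∣x∣≤1)

½k≤oddRatio₂ : ∀ {d} → 2 ℕ.≤ d → ½ * ℕ→ℚ (suc d) ≤ oddRatio d 2
½k≤oddRatio₂ {d} 2≤d =
  subst (λ d → ½ * ℕ→ℚ (suc d) ≤ oddRatio d 2) (ℕ.m+[n∸m]≡n 2≤d)
  (½k≤ratio {ℕ→ℚ (suc (2 ℕ.+ p))} {oddθ (2 ℕ.+ p) 2} (ℕ→ℚ-pos {suc (2 ℕ.+ p)} (s≤s z≤n))
             (k-θ₂≡2 p) (1≤1-x (SecondEigenvalue.oddW₂≤0 p)))
  where
  p : ℕ
  p = d ∸ 2
  1≤1-x : ∀ {x} → x ≤ 0ℚ → 1ℚ ≤ 1ℚ - x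
  1≤1-x x≤0 = +-monoʳ-≤ 1ℚ (neg-antimono-≤ x≤0)

corollary6p3 : (d : ℕ) → 2 ℕ.≤ d →
    ((j : ℕ) → 1 ℕ.≤ j → j ℕ.≤ d → oddRatio d j ≤ oddRatio d 2)
corollary6p3 d 2≤d j 1≤j j≤d with j ℕ.≟ 2
... | yes refl = ≤-refl
... | no j≢2   = ≤-trans (oddRatio≤½k 2≤d 1≤j j≤d j≢2) (½k≤oddRatio₂ 2≤d)
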